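{- Let $G$ be an $s$-$t$ graph and let $p_1,p_2$ be two distinct maximal univocal paths of $G$. Then $p_1$ and $p_2$ are vertex disjoint.
   Context: An $s$-$t$ graph is a directed graph without parallel edges (self-loops allowed) with a unique source $s$ and a unique sink $t$. A vertex $u$ $s$-dominates $v$ if every $s$-$v$ path contains $u$; $u$ $t$-dominates $v$ if every $v$-$t$ path contains $u$. The $s$-dominator tree is the tree rooted at $s$ in which each vertex $v\neq s$ has as parent its immediate $s$-dominator; the $t$-dominator tree is defined analogously, rooted at $t$. A univocal path of $G$ is a sequence of distinct vertices $p=v_1\dots v_k$ ($k\ge1$) such that: in the $t$-dominator tree, $v_1\dots v_k$ is a path where, for $i=1,\dots,k-1$, $v_{i+1}$ is the parent of $v_i$ and $v_i$ is the unique child of $v_{i+1}$; and in the $s$-dominator tree, $v_k\dots v_1$ is a path (with $v_1$ the shallowest and $v_k$ the deepest vertex) in which every vertex except the deepest one has exactly one child. A single vertex is a univocal path. A univocal path is maximal if it is not a proper subpath of another univocal path. -}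

module Defs where

open import Data.Nat using (ℕ)
open import Data.Fin using (Fin)
open import Data.Bool using (Bool; true)
open import Data.List using (List; []; _∷_; _++_; last)
open import Data.List.Membership.Propositional using (_∈_)
open import Data.List.Relation.Unary.Unique.Propositional using (Unique)
open import Data.Maybe using (just)
open import Data.Product using (Σ; ∃; _×_)
open import Data.Unit using (⊤)
open import Data.Empty using (⊥)
open import Relation.Binary.PropositionalEquality using (_≡_; _≢_)
open import Relation.Nullary using (¬_)

-- A finite directed graph on vertex set Fin n, given by a Boolean adjacency
-- relation (so no parallel edges; self-loops allowed).
Graph : ℕ → Set
Graph n = Fin n → Fin n → Bool

module _ {n : ℕ} (G : Graph n) where

  Edge : Fin n → Fin n → Set
  Edge u v = G u v ≡ true

  IsWalk : List (Fin n) → Set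
  IsWalk []            = ⊥
  IsWalk (v ∷ [])      = ⊤
  IsWalk (u ∷ v ∷ vs)  = Edge u v × IsWalk (v ∷ vs)

  WalkFromTo : Fin n → Fin n → List (Fin n) → Set
  WalkFromTo x y []       = ⊥
  WalkFromTo x y (v ∷ vs) = (x ≡ v) × IsWalk (v ∷ vs) × (last (v ∷ vs) ≡ just y)

  PathFromTo : Fin n → Fin n → List (Fin n) → Set
  PathFromTo x y p = WalkFromTo x y p × Unique p

  Reaches : Fin n → Fin n → Set
  Reaches x y = ∃ λ p → PathFromTo x y p

  IsSource : Fin n → Set
  IsSource v = ∀ u → ¬ Edge u v

  IsSink : Fin n → Set
  IsSink v = ∀ w → ¬ Edge v w

  record IsSTGraph (s t : Fin n) : Set where
    field
      s-source  : IsSource s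
      s-unique  : ∀ v → IsSource v → v ≡ s
      t-sink    : IsSink t
      t-unique  : ∀ v → IsSink v → v ≡ t
      from-s    : ∀ v → Reaches s v
      to-t      : ∀ v → Reaches v t

  module _ (s t : Fin n) where

    SDom : Fin n → Fin n → Set
    SDom u v = ∀ p → PathFromTo s v p → u ∈ p

    TDom : Fin n → Fin n → Set
    TDom u v = ∀ p → PathFromTo v t p → u ∈ p

    -- u is the immediate s-dominator of v (= parent of v in the s-dominator
    -- tree): u strictly s-dominates v and every strict s-dominator of v
    -- s-dominates u.
    SParent : Fin n → Fin n → Set
    SParent u v = u ≢ v × SDom u v × (∀ w → w ≢ v → SDom w v → SDom w u)

    TParent : Fin n → Fin n → Set
    TParent u v = u ≢ v × TDom u v × (∀ w → w ≢ v → TDom w v → TDom w u)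

    -- Univocal-path conditions on consecutive vertices of v₁ … v_k:
    -- in the t-dominator tree v_{i+1} is the parent of v_i and v_i is its
    -- unique child; in the s-dominator tree v_i is the parent of v_{i+1}
    -- and v_{i+1} is its unique child (v_k, the deepest, is unconstrained).
    UnivocalLinks : List (Fin n) → Set
    UnivocalLinks []           = ⊥
    UnivocalLinks (v ∷ [])     = ⊤
    UnivocalLinks (v ∷ w ∷ vs) =
        TParent w v × (∀ c → TParent w c → c ≡ v)
      × SParent v w × (∀ c → SParent v c → c ≡ w)
      × UnivocalLinks (w ∷ vs)

    IsUnivocal : List (Fin n) → Set
    IsUnivocal p = Unique p × UnivocalLinks p

    SubpathOf : List (Fin n) → List (Fin n) → Set
    SubpathOf p q = ∃ λ xs → ∃ λ ys → q ≡ xs ++ p ++ ys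

    IsMaximalUnivocal : List (Fin n) → Set
    IsMaximalUnivocal p =
      IsUnivocal p × (∀ q → IsUnivocal q → SubpathOf p q → q ≡ p)

{-# OPTIONS --safe #-}
module Submission where

-- Consecutive vertices of a univocal path are related by a link relation that is
-- functional (an s-dominator-tree parent has a unique child) and injective (a
-- t-dominator-tree parent has a unique child), and links refine strict
-- s-dominance, which is a strict partial order.  So univocal paths are the chains
-- of an acyclic partial injection; a maximal one has a head without predecessor
-- and a last vertex without successor, and two such chains through a common
-- vertex coincide.

open import Defs
open import Data.Nat using (ℕ)
open import Data.Fin using (Fin)
open import Data.List using (List; []; _∷_; _∷ʳ_; head; last)
open import Data.List.Properties using (++-identityʳ; ++-cancelˡ; ++-cancelʳ)
open import Data.List.Membership.Propositional using (_∈_)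
open import Data.List.Relation.Binary.Subset.Propositional using (_⊆_)
open import Data.List.Relation.Unary.Any using (here; there)
open import Data.List.Relation.Unary.All as All using ([])
open import Data.List.Relation.Unary.AllPairs as AllPairs using ([]; _∷_)
open import Data.List.Relation.Unary.Linked as Linked using (Linked; []; [-]; _∷_)
open import Data.List.Relation.Unary.Linked.Properties using (Linked⇒AllPairs; ++⁺)
open import Data.List.Relation.Unary.Unique.Propositional using (Unique)
open import Data.Maybe using (just; nothing)
open import Data.Maybe.Properties using (just-injective)
open import Data.Maybe.Relation.Binary.Connected using (Connected; just)
open import Data.Maybe.Relation.Unary.All as Maybe using (just; nothing)
open import Data.Product using (∃-syntax; _×_; _,_; proj₁)
open import Data.Unit using (tt)
open import Data.Empty using (⊥; ⊥-elim)
open import Relation.Binary.PropositionalEquality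
  using (_≡_; _≢_; refl; sym; trans; cong; subst)
open import Relation.Nullary using (¬_)
open import Function using (_∘_)

module _ {A : Set} where

  last-∈ : ∀ (xs : List A) {y} → last xs ≡ just y → y ∈ xs
  last-∈ (x ∷ [])     eq = here (sym (just-injective eq))
  last-∈ (x ∷ z ∷ zs) eq = there (last-∈ (z ∷ zs) eq)

  ∷-≢ : ∀ (u : A) xs → u ∷ xs ≢ xs
  ∷-≢ u xs eq with () ← ++-cancelʳ xs (u ∷ []) [] eq

  ∷ʳ-≢ : ∀ (xs : List A) u → xs ∷ʳ u ≢ xs
  ∷ʳ-≢ xs u eq with () ← ++-cancelˡ xs (u ∷ []) [] (trans eq (sym (++-identityʳ xs)))

module PartialInjection {A : Set} (_↝_ : A → A → Set)
  (functional : ∀ {u v w} → u ↝ v → u ↝ w → v ≡ w)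
  (injective  : ∀ {u v w} → u ↝ w → v ↝ w → u ≡ v)
  where

  Initial : A → Set
  Initial x = ∀ u → ¬ u ↝ x

  Terminal : A → Set
  Terminal x = ∀ w → ¬ x ↝ w

  Inextensible : List A → Set
  Inextensible p = Maybe.All Initial (head p) × Maybe.All Terminal (last p)

  predecessor-in-chain : ∀ {y ys z} → Linked _↝_ (y ∷ ys) → z ∈ ys →
                         ∃[ u ] u ∈ y ∷ ys × u ↝ z
  predecessor-in-chain (y↝y′ ∷ _) (here refl) = _ , here refl , y↝y′
  predecessor-in-chain (_ ∷ chain) (there z∈ys)
    with u , u∈ , u↝z ← predecessor-in-chain chain z∈ys = u , there u∈ , u↝z

  initial-∈-chain⇒head : ∀ {x y ys} → Linked _↝_ (y ∷ ys) → Initial x →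
                         x ∈ y ∷ ys → x ≡ y
  initial-∈-chain⇒head _ _ (here x≡y) = x≡y
  initial-∈-chain⇒head chain initial (there x∈ys)
    with u , _ , u↝x ← predecessor-in-chain chain x∈ys = ⊥-elim (initial u u↝x)

  -- Once the second vertex z of x ∷ xs is known to lie in y ∷ ys, it is not the
  -- initial y (as x ↝ z), so it has a predecessor in y ∷ ys, which injectivity
  -- identifies with x.
  head-∈-initial-chain : ∀ {x xs y ys v} →
    Linked _↝_ (x ∷ xs) → Linked _↝_ (y ∷ ys) → Initial y →
    v ∈ x ∷ xs → v ∈ y ∷ ys → x ∈ y ∷ ys
  head-∈-initial-chain _ _ _ (here refl) v∈ys = v∈ys
  head-∈-initial-chain (x↝z ∷ chainˣ) chainʸ initial (there v∈xs) v∈ys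
    with head-∈-initial-chain chainˣ chainʸ initial v∈xs v∈ys
  ... | here refl = ⊥-elim (initial _ x↝z)
  ... | there z∈ys with u , u∈ , u↝z ← predecessor-in-chain chainʸ z∈ys =
    subst (_∈ _) (injective u↝z x↝z) u∈

  terminal-chains-from⇒≡ : ∀ {x xs ys} → Linked _↝_ (x ∷ xs) → Linked _↝_ (x ∷ ys) →
    Maybe.All Terminal (last (x ∷ xs)) → Maybe.All Terminal (last (x ∷ ys)) → xs ≡ ys
  terminal-chains-from⇒≡ [-] [-] _ _ = refl
  terminal-chains-from⇒≡ [-] (x↝y ∷ _) (just terminal) _ = ⊥-elim (terminal _ x↝y)
  terminal-chains-from⇒≡ (x↝y ∷ _) [-] _ (just terminal) = ⊥-elim (terminal _ x↝y)
  terminal-chains-from⇒≡ (x↝y ∷ chainˣ) (x↝y′ ∷ chainʸ) endˣ endʸ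
    with refl ← functional x↝y x↝y′ =
    cong (_ ∷_) (terminal-chains-from⇒≡ chainˣ chainʸ endˣ endʸ)

  inextensible-chains-meet⇒≡ : ∀ {p q v} → Linked _↝_ p → Linked _↝_ q →
    Inextensible p → Inextensible q → v ∈ p → v ∈ q → p ≡ q
  inextensible-chains-meet⇒≡ {x ∷ xs} {y ∷ ys} chainᵖ chainᵠ
    (just initialˣ , endᵖ) (just initialʸ , endᵠ) v∈p v∈q
    with refl ← initial-∈-chain⇒head chainᵠ initialˣ
                  (head-∈-initial-chain chainᵖ chainᵠ initialʸ v∈p v∈q) =
    cong (x ∷_) (terminal-chains-from⇒≡ chainᵖ chainᵠ endᵖ endᵠ)

module Dominance {n : ℕ} (G : Graph n) (s t : Fin n) where

  path-prefix : ∀ {x y v p} → PathFromTo G x y p → v ∈ p →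
    ∃[ q ] PathFromTo G x v q × q ⊆ p × (y ∈ q → y ≡ v)
  path-prefix {p = u ∷ _} ((refl , _) , _) (here refl) =
    u ∷ [] , ((refl , tt , refl) , [] ∷ []) ,
    (λ { (here refl) → here refl }) , (λ { (here y≡u) → y≡u })
  path-prefix {p = u ∷ u′ ∷ us} ((refl , (u↝u′ , walk) , end) , (u∉ ∷ unique)) (there v∈)
    with path-prefix ((refl , walk , end) , unique) v∈
  ... | [] , (() , _) , _
  ... | q@(_ ∷ _) , ((refl , walkᵠ , endᵠ) , uniqueᵠ) , q⊆ , y∈q⇒y≡v =
    u ∷ q , ((refl , (u↝u′ , walkᵠ) , endᵠ) , All.tabulate (All.lookup u∉ ∘ q⊆) ∷ uniqueᵠ) ,
    (λ { (here refl) → here refl ; (there z∈q) → there (q⊆ z∈q) }) ,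
    λ { (here refl) → ⊥-elim (All.lookup u∉ (last-∈ (u′ ∷ us) end) refl)
      ; (there y∈q) → y∈q⇒y≡v y∈q }

  SDom-trans : ∀ {a b c} → SDom G s t a b → SDom G s t b c → SDom G s t a c
  SDom-trans a≼b b≼c p path with q , pathᵠ , q⊆p , _ ← path-prefix path (b≼c p path) =
    q⊆p (a≼b q pathᵠ)

  SDom-antisym : (∀ v → Reaches G s v) →
    ∀ {a b} → a ≢ b → SDom G s t a b → SDom G s t b a → ⊥
  SDom-antisym reachable {a} {b} a≢b a≼b b≼a
    with p , path ← reachable b
    with q , pathᵠ , _ , b∈q⇒b≡a ← path-prefix path (a≼b p path) =
    a≢b (sym (b∈q⇒b≡a (b≼a q pathᵠ)))

  StrictSDom : Fin n → Fin n → Set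
  StrictSDom a b = a ≢ b × SDom G s t a b

  StrictSDom-trans : (∀ v → Reaches G s v) →
    ∀ {a b c} → StrictSDom a b → StrictSDom b c → StrictSDom a c
  StrictSDom-trans reachable (a≢b , a≼b) (b≢c , b≼c) =
    (λ { refl → SDom-antisym reachable a≢b a≼b b≼c }) , SDom-trans a≼b b≼c

module Univocal {n : ℕ} (G : Graph n) (s t : Fin n) (st : IsSTGraph G s t) where
  open Dominance G s t

  UnivocalLink : Fin n → Fin n → Set
  UnivocalLink v w =
      TParent G s t w v × (∀ c → TParent G s t w c → c ≡ v)
    × SParent G s t v w × (∀ c → SParent G s t v c → c ≡ w)

  UnivocalLink-functional : ∀ {u v w} → UnivocalLink u v → UnivocalLink u w → v ≡ w
  UnivocalLink-functional (_ , _ , _ , only-child) (_ , _ , u-parent-w , _) =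
    sym (only-child _ u-parent-w)

  UnivocalLink-injective : ∀ {u v w} → UnivocalLink u w → UnivocalLink v w → u ≡ v
  UnivocalLink-injective (_ , only-child , _ , _) (w-parent-v , _ , _ , _) =
    sym (only-child _ w-parent-v)

  links⇒linked : ∀ {x xs} → UnivocalLinks G s t (x ∷ xs) → Linked UnivocalLink (x ∷ xs)
  links⇒linked {xs = []}    tt                 = [-]
  links⇒linked {xs = _ ∷ _} (a , b , c , d , l) = (a , b , c , d) ∷ links⇒linked l

  linked⇒links : ∀ {x xs} → Linked UnivocalLink (x ∷ xs) → UnivocalLinks G s t (x ∷ xs)
  linked⇒links [-]                 = tt
  linked⇒links ((a , b , c , d) ∷ l) = a , b , c , d , linked⇒links l

  linked⇒unique : ∀ {p} → Linked UnivocalLink p → Unique p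
  linked⇒unique chain =
    AllPairs.map proj₁
      (Linked⇒AllPairs (StrictSDom-trans (IsSTGraph.from-s st))
        (Linked.map (λ (_ , _ , (v≢w , v≼w , _) , _) → v≢w , v≼w) chain))

  linked⇒univocal : ∀ {x xs} → Linked UnivocalLink (x ∷ xs) → IsUnivocal G s t (x ∷ xs)
  linked⇒univocal chain = linked⇒unique chain , linked⇒links chain

  open PartialInjection UnivocalLink UnivocalLink-functional UnivocalLink-injective public

  maximal⇒linked : ∀ {p} → IsMaximalUnivocal G s t p → Linked UnivocalLink p
  maximal⇒linked {_ ∷ _} ((_ , links) , _) = links⇒linked links

  maximal⇒initial-head : ∀ {p} → IsMaximalUnivocal G s t p → Maybe.All Initial (head p)
  maximal⇒initial-head {x ∷ xs} maximal@(_ , only-self) = just λ u u↝x →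
    ∷-≢ u (x ∷ xs)
      (only-self (u ∷ x ∷ xs) (linked⇒univocal (u↝x ∷ maximal⇒linked maximal))
        (u ∷ [] , [] , cong (u ∷_) (sym (++-identityʳ (x ∷ xs)))))

  maximal⇒terminal-last : ∀ {p} → IsMaximalUnivocal G s t p → Maybe.All Terminal (last p)
  maximal⇒terminal-last {x ∷ xs} maximal@(_ , only-self) with last (x ∷ xs) in end
  ... | nothing = nothing
  ... | just y = just λ u y↝u →
    let y↝u′ = subst (λ m → Connected UnivocalLink m (just u)) (sym end) (just y↝u)
        chain = ++⁺ (maximal⇒linked maximal) y↝u′ [-]
    in ∷ʳ-≢ (x ∷ xs) u (only-self ((x ∷ xs) ∷ʳ u) (linked⇒univocal chain) ([] , u ∷ [] , refl))

  maximal⇒inextensible : ∀ {p} → IsMaximalUnivocal G s t p → Inextensible p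
  maximal⇒inextensible maximal = maximal⇒initial-head maximal , maximal⇒terminal-last maximal

lemma3p4 : (n : ℕ) (G : Graph n) (s t : Fin n) → IsSTGraph G s t →
    (p₁ p₂ : List (Fin n)) →
    IsMaximalUnivocal G s t p₁ → IsMaximalUnivocal G s t p₂ → p₁ ≢ p₂ →
    (v : Fin n) → v ∈ p₁ → v ∈ p₂ → ⊥
lemma3p4 n G s t st p₁ p₂ maximal₁ maximal₂ p₁≢p₂ v v∈p₁ v∈p₂ =
  p₁≢p₂ (inextensible-chains-meet⇒≡
           (maximal⇒linked maximal₁) (maximal⇒linked maximal₂)
           (maximal⇒inextensible maximal₁) (maximal⇒inextensible maximal₂) v∈p₁ v∈p₂)
  where open Univocal G s t st
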